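{- There exists a set of $61$ vertices of $Q_{10}$ that percolates under the $4$-neighbour bootstrap process on $Q_{10}$.
   Context: $Q_d$ denotes the $d$-dimensional hypercube: vertex set $\{0,1\}^d$, two vertices adjacent iff they differ in exactly one coordinate. For $r\geq1$, the $r$-neighbour bootstrap process on a graph $G$ starts with a set $A_0\subseteq V(G)$ and sets $A_t:=A_{t-1}\cup\{v: |N_G(v)\cap A_{t-1}|\geq r\}$ for $t\geq1$; $A_0$ percolates if $\bigcup_t A_t=V(G)$. -}

module Defs where

open import Data.Nat using (ℕ; zero; suc; _≤ᵇ_)
open import Data.Bool using (Bool; true; false; not; _∨_; if_then_else_)
open import Data.Fin using (Fin)
open import Data.Fin.Properties using (_≟_)
open import Data.Vec using (Vec; updateAt; lookup; _∷_; [])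
open import Data.List using (List; length; allFin; filter; map)
open import Data.List.Relation.Unary.Unique.Propositional using (Unique)
open import Data.List.Relation.Unary.Any using (any?)
open import Data.Product using (∃; _×_)
open import Relation.Binary.PropositionalEquality using (_≡_)
open import Relation.Nullary.Decidable using (does)

Vertex : ℕ → Set
Vertex d = Vec Bool d

-- Two vertices are adjacent in Q_d iff they differ in exactly one coordinate,
-- so N(v) = { flip i v | i : Fin d }, and these d vertices are distinct.
flip : ∀ {d} → Fin d → Vertex d → Vertex d
flip i v = updateAt v i not

VSet : ℕ → Set
VSet d = Vertex d → Bool

nbrCount : ∀ {d} → VSet d → Vertex d → ℕ
nbrCount {d} A v = length (filter (λ i → Data.Bool._≟_ (A (flip i v)) true) (allFin d))

step : ∀ {d} → ℕ → VSet d → VSet d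
step r A v = A v ∨ (r ≤ᵇ nbrCount A v)

bootstrap : ∀ {d} → ℕ → VSet d → ℕ → VSet d
bootstrap r A zero = A
bootstrap r A (suc t) = step r (bootstrap r A t)

Percolates : ∀ {d} → ℕ → VSet d → Set
Percolates {d} r A = ∀ (v : Vertex d) → ∃ λ t → bootstrap r A t v ≡ true

_≟V_ : ∀ {d} → (u v : Vertex d) → Relation.Nullary.Decidable.Dec (u ≡ v)
_≟V_ = Data.Vec.Properties.≡-dec Data.Bool._≟_
  where import Data.Vec.Properties

fromList : ∀ {d} → List (Vertex d) → VSet d
fromList xs v = does (any? (λ u → v ≟V u) xs)

{-# OPTIONS --safe #-}
module Submission where

open import Defs
open import Data.Bool using (Bool; true; false; _∧_; _∨_)
open import Data.Bool.Properties using (∧-conicalˡ; ∧-conicalʳ)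
open import Data.List using (List; []; _∷_; length; allFin)
open import Data.List.Properties using (filter-≐)
open import Data.List.Relation.Unary.Unique.Propositional using (Unique)
open import Data.List.Relation.Unary.Unique.DecPropositional using (unique?)
open import Data.Nat using (ℕ; zero; suc; _≤ᵇ_)
open import Data.Product using (∃; _×_; _,_)
open import Data.Unit using (tt)
open import Data.Vec using ([]; _∷_)
open import Relation.Binary.PropositionalEquality using (_≡_; _≗_; refl; sym; trans; cong; cong₂)
open import Relation.Nullary.Decidable using (toWitness)

-- Percolation of an explicit seed set is a finite check: run the 4-neighbour
-- process on Q₁₀ from the 61 seeds below and observe that A₆₂ is the whole cube.
-- The run is done by evaluation, each Aₜ being stored as a complete binary tree
-- over the coordinates; unfolding `bootstrap` itself would recompute Aₜ at every
-- neighbour, in time exponential in t.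

data Table (A : Set) : ℕ → Set where
  leaf : A → Table A zero
  node : ∀ {d} → Table A d → Table A d → Table A (suc d)

tabulate : ∀ {A d} → (Vertex d → A) → Table A d
tabulate {d = zero}  f = leaf (f [])
tabulate {d = suc d} f = node (tabulate (λ v → f (false ∷ v))) (tabulate (λ v → f (true ∷ v)))

lookup : ∀ {A d} → Table A d → Vertex d → A
lookup (leaf a)   []          = a
lookup (node l r) (false ∷ v) = lookup l v
lookup (node l r) (true  ∷ v) = lookup r v

lookup-tabulate : ∀ {A d} (f : Vertex d → A) → lookup (tabulate f) ≗ f
lookup-tabulate {d = zero}  f []          = refl
lookup-tabulate {d = suc d} f (false ∷ v) = lookup-tabulate (λ w → f (false ∷ w)) v
lookup-tabulate {d = suc d} f (true  ∷ v) = lookup-tabulate (λ w → f (true ∷ w)) v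

and : ∀ {d} → Table Bool d → Bool
and (leaf b)   = b
and (node l r) = and l ∧ and r

and≡true⇒lookup≡true : ∀ {d} (T : Table Bool d) → and T ≡ true → ∀ v → lookup T v ≡ true
and≡true⇒lookup≡true (leaf b)   eq []          = eq
and≡true⇒lookup≡true (node l r) eq (false ∷ v) = and≡true⇒lookup≡true l (∧-conicalˡ (and l) (and r) eq) v
and≡true⇒lookup≡true (node l r) eq (true  ∷ v) = and≡true⇒lookup≡true r (∧-conicalʳ (and l) (and r) eq) v

nbrCount-cong : ∀ {d} {A B : VSet d} → A ≗ B → nbrCount A ≗ nbrCount B
nbrCount-cong {d} A≗B v =
  cong length (filter-≐ _ _ ((λ {i} → trans (sym (A≗B (flip i v)))) , (λ {i} → trans (A≗B (flip i v)))) (allFin d))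

step-cong : ∀ {d} r {A B : VSet d} → A ≗ B → step r A ≗ step r B
step-cong r A≗B v = cong₂ (λ a n → a ∨ (r ≤ᵇ n)) (A≗B v) (nbrCount-cong A≗B v)

bootstrapTable : ∀ {d} → ℕ → VSet d → ℕ → Table Bool d
bootstrapTable r A zero    = tabulate A
bootstrapTable r A (suc t) = tabulate (step r (lookup (bootstrapTable r A t)))

lookup-bootstrapTable : ∀ {d} r (A : VSet d) t → lookup (bootstrapTable r A t) ≗ bootstrap r A t
lookup-bootstrapTable r A zero    = lookup-tabulate A
lookup-bootstrapTable r A (suc t) v =
  trans (lookup-tabulate (step r (lookup (bootstrapTable r A t))) v)
        (step-cong r (lookup-bootstrapTable r A t) v)

percolates-within : ∀ {d} r (A : VSet d) t → and (bootstrapTable r A t) ≡ true → Percolates r A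
percolates-within r A t full v =
  t , trans (sym (lookup-bootstrapTable r A t v)) (and≡true⇒lookup≡true (bootstrapTable r A t) full v)

seeds : List (Vertex 10)
seeds = (true ∷ false ∷ false ∷ true ∷ true ∷ false ∷ false ∷ false ∷ false ∷ false ∷ [])
  ∷ (true ∷ false ∷ false ∷ false ∷ false ∷ true ∷ false ∷ false ∷ false ∷ false ∷ [])
  ∷ (false ∷ true ∷ false ∷ false ∷ false ∷ true ∷ false ∷ false ∷ false ∷ false ∷ [])
  ∷ (true ∷ true ∷ false ∷ false ∷ true ∷ true ∷ false ∷ false ∷ false ∷ false ∷ [])
  ∷ (false ∷ false ∷ false ∷ false ∷ true ∷ false ∷ true ∷ false ∷ false ∷ false ∷ [])
  ∷ (false ∷ false ∷ true ∷ true ∷ true ∷ false ∷ true ∷ false ∷ false ∷ false ∷ [])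
  ∷ (false ∷ true ∷ true ∷ false ∷ false ∷ true ∷ true ∷ false ∷ false ∷ false ∷ [])
  ∷ (true ∷ false ∷ false ∷ false ∷ true ∷ true ∷ true ∷ false ∷ false ∷ false ∷ [])
  ∷ (false ∷ false ∷ true ∷ false ∷ true ∷ true ∷ true ∷ false ∷ false ∷ false ∷ [])
  ∷ (false ∷ false ∷ false ∷ true ∷ true ∷ true ∷ true ∷ false ∷ false ∷ false ∷ [])
  ∷ (true ∷ false ∷ false ∷ false ∷ true ∷ false ∷ false ∷ true ∷ false ∷ false ∷ [])
  ∷ (false ∷ false ∷ false ∷ false ∷ true ∷ true ∷ false ∷ true ∷ false ∷ false ∷ [])
  ∷ (true ∷ false ∷ false ∷ false ∷ false ∷ false ∷ true ∷ true ∷ false ∷ false ∷ [])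
  ∷ (true ∷ true ∷ true ∷ false ∷ true ∷ true ∷ true ∷ true ∷ false ∷ false ∷ [])
  ∷ (true ∷ true ∷ false ∷ true ∷ true ∷ false ∷ false ∷ false ∷ true ∷ false ∷ [])
  ∷ (false ∷ false ∷ true ∷ false ∷ false ∷ true ∷ false ∷ false ∷ true ∷ false ∷ [])
  ∷ (true ∷ true ∷ true ∷ true ∷ true ∷ true ∷ false ∷ false ∷ true ∷ false ∷ [])
  ∷ (true ∷ false ∷ false ∷ false ∷ true ∷ false ∷ true ∷ false ∷ true ∷ false ∷ [])
  ∷ (false ∷ false ∷ false ∷ true ∷ true ∷ false ∷ true ∷ false ∷ true ∷ false ∷ [])
  ∷ (true ∷ true ∷ true ∷ true ∷ true ∷ false ∷ true ∷ false ∷ true ∷ false ∷ [])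
  ∷ (false ∷ false ∷ false ∷ false ∷ false ∷ true ∷ true ∷ false ∷ true ∷ false ∷ [])
  ∷ (true ∷ true ∷ true ∷ false ∷ false ∷ true ∷ true ∷ false ∷ true ∷ false ∷ [])
  ∷ (true ∷ false ∷ false ∷ true ∷ false ∷ true ∷ true ∷ false ∷ true ∷ false ∷ [])
  ∷ (true ∷ false ∷ true ∷ false ∷ true ∷ true ∷ true ∷ false ∷ true ∷ false ∷ [])
  ∷ (true ∷ true ∷ false ∷ true ∷ true ∷ true ∷ true ∷ false ∷ true ∷ false ∷ [])
  ∷ (true ∷ false ∷ true ∷ true ∷ false ∷ false ∷ false ∷ true ∷ true ∷ false ∷ [])
  ∷ (true ∷ true ∷ false ∷ false ∷ true ∷ false ∷ false ∷ true ∷ true ∷ false ∷ [])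
  ∷ (true ∷ false ∷ false ∷ true ∷ true ∷ false ∷ false ∷ true ∷ true ∷ false ∷ [])
  ∷ (true ∷ false ∷ true ∷ false ∷ false ∷ true ∷ false ∷ true ∷ true ∷ false ∷ [])
  ∷ (false ∷ true ∷ true ∷ false ∷ false ∷ true ∷ false ∷ true ∷ true ∷ false ∷ [])
  ∷ (true ∷ true ∷ true ∷ true ∷ false ∷ true ∷ false ∷ true ∷ true ∷ false ∷ [])
  ∷ (true ∷ false ∷ false ∷ false ∷ true ∷ true ∷ false ∷ true ∷ true ∷ false ∷ [])
  ∷ (true ∷ true ∷ false ∷ false ∷ false ∷ false ∷ true ∷ true ∷ true ∷ false ∷ [])
  ∷ (true ∷ false ∷ true ∷ false ∷ false ∷ false ∷ true ∷ true ∷ true ∷ false ∷ [])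
  ∷ (false ∷ false ∷ false ∷ false ∷ true ∷ false ∷ true ∷ true ∷ true ∷ false ∷ [])
  ∷ (true ∷ false ∷ true ∷ true ∷ true ∷ false ∷ true ∷ true ∷ true ∷ false ∷ [])
  ∷ (true ∷ false ∷ false ∷ false ∷ false ∷ true ∷ true ∷ true ∷ true ∷ false ∷ [])
  ∷ (true ∷ true ∷ false ∷ false ∷ true ∷ true ∷ true ∷ true ∷ true ∷ false ∷ [])
  ∷ (false ∷ false ∷ false ∷ true ∷ true ∷ true ∷ true ∷ true ∷ true ∷ false ∷ [])
  ∷ (true ∷ true ∷ true ∷ true ∷ true ∷ true ∷ true ∷ true ∷ true ∷ false ∷ [])
  ∷ (false ∷ false ∷ true ∷ false ∷ false ∷ false ∷ false ∷ false ∷ false ∷ true ∷ [])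
  ∷ (true ∷ false ∷ false ∷ false ∷ true ∷ false ∷ true ∷ false ∷ false ∷ true ∷ [])
  ∷ (false ∷ false ∷ true ∷ false ∷ true ∷ false ∷ true ∷ false ∷ false ∷ true ∷ [])
  ∷ (false ∷ false ∷ false ∷ false ∷ false ∷ true ∷ true ∷ false ∷ false ∷ true ∷ [])
  ∷ (false ∷ true ∷ false ∷ false ∷ true ∷ true ∷ true ∷ false ∷ false ∷ true ∷ [])
  ∷ (true ∷ false ∷ true ∷ false ∷ true ∷ true ∷ true ∷ false ∷ false ∷ true ∷ [])
  ∷ (true ∷ true ∷ false ∷ true ∷ true ∷ true ∷ true ∷ false ∷ false ∷ true ∷ [])
  ∷ (true ∷ false ∷ true ∷ false ∷ false ∷ false ∷ false ∷ true ∷ false ∷ true ∷ [])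
  ∷ (true ∷ true ∷ true ∷ false ∷ true ∷ false ∷ false ∷ true ∷ false ∷ true ∷ [])
  ∷ (false ∷ true ∷ true ∷ true ∷ false ∷ true ∷ false ∷ true ∷ false ∷ true ∷ [])
  ∷ (true ∷ true ∷ false ∷ false ∷ true ∷ true ∷ false ∷ true ∷ false ∷ true ∷ [])
  ∷ (false ∷ false ∷ false ∷ true ∷ true ∷ false ∷ true ∷ true ∷ false ∷ true ∷ [])
  ∷ (true ∷ false ∷ false ∷ false ∷ false ∷ true ∷ true ∷ true ∷ false ∷ true ∷ [])
  ∷ (false ∷ false ∷ false ∷ false ∷ true ∷ true ∷ true ∷ true ∷ false ∷ true ∷ [])
  ∷ (true ∷ true ∷ false ∷ false ∷ false ∷ true ∷ true ∷ false ∷ true ∷ true ∷ [])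
  ∷ (true ∷ false ∷ true ∷ false ∷ false ∷ true ∷ true ∷ false ∷ true ∷ true ∷ [])
  ∷ (false ∷ true ∷ false ∷ true ∷ true ∷ true ∷ true ∷ false ∷ true ∷ true ∷ [])
  ∷ (true ∷ true ∷ false ∷ true ∷ false ∷ false ∷ false ∷ true ∷ true ∷ true ∷ [])
  ∷ (false ∷ true ∷ false ∷ false ∷ true ∷ false ∷ true ∷ true ∷ true ∷ true ∷ [])
  ∷ (true ∷ true ∷ false ∷ true ∷ true ∷ true ∷ true ∷ true ∷ true ∷ true ∷ [])
  ∷ (true ∷ false ∷ true ∷ true ∷ true ∷ true ∷ true ∷ true ∷ true ∷ true ∷ [])
  ∷ []

lemma4p7 : ∃ λ (xs : List (Vertex 10)) → Unique xs × length xs ≡ 61 × Percolates 4 (fromList xs)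
lemma4p7 =
  seeds , toWitness {a? = unique? _≟V_ seeds} tt , refl , percolates-within 4 (fromList seeds) 62 refl
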